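{- Let $k\ge1$ be an integer. If $G$ is a finite simple graph of order $n\ge 2$, then $$\gamma_{kR}(G)+d_R^k(G)\le n+2k,$$ with equality if and only if either $\gamma_{kR}(G)=n$ and $d_R^k(G)=2k$, or $\gamma_{kR}(G)=2k$ and $d_R^k(G)=n$.
   Context: Let $k\ge1$ be an integer. A Roman $k$-dominating function (RkDF) on a graph $G$ is a map $f:V(G)\to\{0,1,2\}$ such that every vertex $v$ with $f(v)=0$ has at least $k$ neighbors $u$ with $f(u)=2$. Its weight is $\sum_{v\in V(G)}f(v)$. The Roman $k$-domination number $\gamma_{kR}(G)$ is the minimum weight of an RkDF on $G$. A set $\{f_1,\ldots,f_d\}$ of pairwise distinct RkDFs on $G$ with $\sum_{i=1}^d f_i(v)\le 2k$ for every $v\in V(G)$ is a Roman $(k,k)$-dominating family on $G$; the maximum number of functions in such a family is the Roman $(k,k)$-domatic number $d_R^k(G)$. -}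

module Defs where

open import Data.Nat using (ℕ; _+_; _*_; _≤_)
open import Data.Bool using (Bool; true; false; if_then_else_; _∧_)
open import Data.Fin using (Fin; toℕ)
open import Data.List using (List; map; allFin)
open import Data.Nat.ListAction using (sum)
open import Data.Vec using (Vec; lookup)
open import Data.Product using (Σ; _×_; ∃)
open import Relation.Binary.PropositionalEquality using (_≡_; _≢_)
open import Relation.Nullary using (¬_)

record Graph (n : ℕ) : Set where
  field
    adj    : Fin n → Fin n → Bool
    sym    : ∀ u v → adj u v ≡ adj v u
    irrefl : ∀ v → adj v v ≡ false
open Graph public

-- Maps V(G) → {0,1,2}; the value is toℕ (f v).
Labeling : ℕ → Set
Labeling n = Fin n → Fin 3

isTwo : Fin 3 → Bool
isTwo Fin.zero = false
isTwo (Fin.suc Fin.zero) = false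
isTwo (Fin.suc (Fin.suc Fin.zero)) = true

sumV : ∀ {n} → (Fin n → ℕ) → ℕ
sumV {n} g = sum (map g (allFin n))

twoNeighbours : ∀ {n} → Graph n → Labeling n → Fin n → ℕ
twoNeighbours G f v = sumV (λ u → if adj G v u ∧ isTwo (f u) then 1 else 0)

weight : ∀ {n} → Labeling n → ℕ
weight f = sumV (λ v → toℕ (f v))

IsRkDF : ∀ {n} → Graph n → ℕ → Labeling n → Set
IsRkDF G k f = ∀ v → toℕ (f v) ≡ 0 → k ≤ twoNeighbours G f v

IsRomanKDominationNumber : ∀ {n} → Graph n → ℕ → ℕ → Set
IsRomanKDominationNumber G k m =
  (∃ λ f → IsRkDF G k f × weight f ≡ m) × (∀ f → IsRkDF G k f → m ≤ weight f)

IsRomanKKFamily : ∀ {n} → Graph n → ℕ → {d : ℕ} → Vec (Labeling n) d → Set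
IsRomanKKFamily {n} G k {d} fs =
  (∀ i → IsRkDF G k (lookup fs i)) ×
  (∀ i j → i ≢ j → ¬ (∀ v → lookup fs i v ≡ lookup fs j v)) ×
  (∀ v → sum (map (λ i → toℕ (lookup fs i v)) (allFin d)) ≤ 2 * k)

HasRomanKKFamily : ∀ {n} → Graph n → ℕ → ℕ → Set
HasRomanKKFamily {n} G k d = Σ (Vec (Labeling n) d) (IsRomanKKFamily G k)

IsRomanKKDomaticNumber : ∀ {n} → Graph n → ℕ → ℕ → Set
IsRomanKKDomaticNumber G k d =
  HasRomanKKFamily G k d × (∀ d' → HasRomanKKFamily G k d' → d' ≤ d)

module Submission where

-- Write m = 2k.  The theorem follows from three facts about a graph G of
-- order n and from one arithmetic lemma.
--   (1) The constant labeling 1 is an RkDF of weight n, so γ ≤ n.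
--   (2) An RkDF labelling some vertex 0 gives that vertex at least k
--       neighbours of label 2, so its weight is at least 2k; otherwise every
--       label is at least 1 and the weight is at least n.  Hence 2k ≤ γ or n ≤ γ.
--   (3) Double counting: the d functions of a Roman (k,k)-dominating family
--       each weigh at least γ, and their labels add up to at most 2k at each of
--       the n vertices, so d·γ ≤ n·2k.
-- Arithmetic: if m ≤ γ ≤ n, put γ = m + a and n = γ + b; then
-- n·m + a·b = (m + b)·γ, so d·γ ≤ n·m forces d ≤ m + b, i.e. γ + d ≤ n + m,
-- and equality forces a·b = 0, i.e. γ = m or γ = n.

open import Defs hiding (sym)
open import Data.Nat using (ℕ; _+_; _*_; _≤_; z≤n; s≤s; NonZero; >-nonZero; >-nonZero⁻¹)
open import Data.Nat.Properties
open import Data.Nat.ListAction using (sum)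
open import Data.Nat.Tactic.RingSolver using (solve-∀)
open import Algebra.Properties.CommutativeSemigroup +-commutativeSemigroup using (interchange)
open import Data.Bool using (Bool; true; false; if_then_else_; _∧_)
open import Data.Fin using (Fin; toℕ)
open import Data.Fin.Properties using (any?)
open import Data.List using (List; []; _∷_; map; allFin; length)
open import Data.List.Properties using (length-tabulate)
open import Data.Vec using (Vec; lookup)
open import Data.Product using (_×_; _,_; proj₁; proj₂)
open import Data.Sum using (_⊎_; inj₁; inj₂)
open import Function.Base using (id)
open import Function.Bundles using (_⇔_; mk⇔)
open import Relation.Binary.PropositionalEquality using (_≡_; _≢_; refl; sym; trans; cong)
open import Relation.Nullary using (yes; no)

sumOver : {A : Set} → (A → ℕ) → List A → ℕ
sumOver g xs = sum (map g xs)

sumOver-mono : {A : Set} {g h : A → ℕ} (xs : List A) →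
  (∀ x → g x ≤ h x) → sumOver g xs ≤ sumOver h xs
sumOver-mono []       g≤h = z≤n
sumOver-mono (x ∷ xs) g≤h = +-mono-≤ (g≤h x) (sumOver-mono xs g≤h)

sumOver-const : {A : Set} (c : ℕ) (xs : List A) → sumOver (λ _ → c) xs ≡ length xs * c
sumOver-const c []       = refl
sumOver-const c (x ∷ xs) = cong (c +_) (sumOver-const c xs)

sumOver-scale : {A : Set} (c : ℕ) (g : A → ℕ) (xs : List A) →
  sumOver (λ x → c * g x) xs ≡ c * sumOver g xs
sumOver-scale c g []       = sym (*-zeroʳ c)
sumOver-scale c g (x ∷ xs) =
  trans (cong (c * g x +_) (sumOver-scale c g xs)) (sym (*-distribˡ-+ c (g x) (sumOver g xs)))

sumOver-+ : {A : Set} (g h : A → ℕ) (xs : List A) →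
  sumOver (λ x → g x + h x) xs ≡ sumOver g xs + sumOver h xs
sumOver-+ g h []       = refl
sumOver-+ g h (x ∷ xs) =
  trans (cong (g x + h x +_) (sumOver-+ g h xs))
        (interchange (g x) (h x) (sumOver g xs) (sumOver h xs))

sumOver-swap : {A B : Set} (h : A → B → ℕ) (xs : List A) (ys : List B) →
  sumOver (λ x → sumOver (h x) ys) xs ≡ sumOver (λ y → sumOver (λ x → h x y) xs) ys
sumOver-swap h []       ys = sym (trans (sumOver-const 0 ys) (*-zeroʳ (length ys)))
sumOver-swap h (x ∷ xs) ys =
  trans (cong (sumOver (h x) ys +_) (sumOver-swap h xs ys))
        (sym (sumOver-+ (h x) (λ y → sumOver (λ x′ → h x′ y) xs) ys))

sumV-const : ∀ n (c : ℕ) → sumV {n} (λ _ → c) ≡ n * c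
sumV-const n c = trans (sumOver-const c (allFin n)) (cong (_* c) (length-tabulate {n = n} id))

allOnes : ∀ {n} → Labeling n
allOnes _ = Fin.suc Fin.zero

allOnes-isRkDF : ∀ {n} (G : Graph n) (k : ℕ) → IsRkDF G k allOnes
allOnes-isRkDF G k v ()

weight-allOnes : ∀ n → weight (allOnes {n}) ≡ n
weight-allOnes n = trans (sumV-const n 1) (*-identityʳ n)

twoIndicator-≤ : (b : Bool) (x : Fin 3) → 2 * (if b ∧ isTwo x then 1 else 0) ≤ toℕ x
twoIndicator-≤ false x                            = z≤n
twoIndicator-≤ true Fin.zero                      = z≤n
twoIndicator-≤ true (Fin.suc Fin.zero)            = z≤n
twoIndicator-≤ true (Fin.suc (Fin.suc Fin.zero))  = ≤-refl

twoNeighbours-weight : ∀ {n} (G : Graph n) (f : Labeling n) (v : Fin n) →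
  2 * twoNeighbours G f v ≤ weight f
twoNeighbours-weight {n} G f v =
  ≤-trans (≤-reflexive (sym (sumOver-scale 2 indicator (allFin n))))
          (sumOver-mono (allFin n) (λ u → twoIndicator-≤ (adj G v u) (f u)))
  where
  indicator : Fin n → ℕ
  indicator u = if adj G v u ∧ isTwo (f u) then 1 else 0

nowhereZero-weight : ∀ {n} (f : Labeling n) → (∀ v → toℕ (f v) ≢ 0) → n ≤ weight f
nowhereZero-weight {n} f nonzero =
  ≤-trans (≤-reflexive (sym (weight-allOnes n)))
          (sumOver-mono (allFin n) (λ v → n≢0⇒n>0 (nonzero v)))

rkdf-weight-lower : ∀ {n} (G : Graph n) (k : ℕ) (f : Labeling n) →
  IsRkDF G k f → 2 * k ≤ weight f ⊎ n ≤ weight f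
rkdf-weight-lower G k f isRkDF with any? (λ v → toℕ (f v) ≟ 0)
... | yes (v , fv≡0) =
  inj₁ (≤-trans (*-monoʳ-≤ 2 (isRkDF v fv≡0)) (twoNeighbours-weight G f v))
... | no noZero = inj₂ (nowhereZero-weight f (λ v fv≡0 → noZero (v , fv≡0)))

domination-≤-order : ∀ {n} (G : Graph n) (k γ : ℕ) →
  IsRomanKDominationNumber G k γ → γ ≤ n
domination-≤-order {n} G k γ (_ , minimal) =
  ≤-trans (minimal allOnes (allOnes-isRkDF G k)) (≤-reflexive (weight-allOnes n))

domination-lower : ∀ {n} (G : Graph n) (k γ : ℕ) →
  IsRomanKDominationNumber G k γ → 2 * k ≤ γ ⊎ n ≤ γ
domination-lower G k γ ((f , isRkDF , refl) , _) = rkdf-weight-lower G k f isRkDF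

family-weight : ∀ {n d} (fs : Vec (Labeling n) d) (c : ℕ) →
  (∀ v → sumOver (λ i → toℕ (lookup fs i v)) (allFin d) ≤ c) →
  sumOver (λ i → weight (lookup fs i)) (allFin d) ≤ n * c
family-weight {n} {d} fs c pointwise = begin
  sumOver (λ i → weight (lookup fs i)) (allFin d)
    ≡⟨ sumOver-swap (λ i v → toℕ (lookup fs i v)) (allFin d) (allFin n) ⟩
  sumOver (λ v → sumOver (λ i → toℕ (lookup fs i v)) (allFin d)) (allFin n)
    ≤⟨ sumOver-mono (allFin n) pointwise ⟩
  sumV {n} (λ _ → c)
    ≡⟨ sumV-const n c ⟩
  n * c ∎
  where open ≤-Reasoning

domatic-bound : ∀ {n} (G : Graph n) (k γ d : ℕ) →
  IsRomanKDominationNumber G k γ → HasRomanKKFamily G k d → d * γ ≤ n * (2 * k)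
domatic-bound {n} G k γ d (_ , minimal) (fs , isRkDF , _ , pointwise) = begin
  d * γ                                           ≡⟨ sym (sumV-const d γ) ⟩
  sumV {d} (λ _ → γ)                              ≤⟨ sumOver-mono (allFin d) (λ i → minimal _ (isRkDF i)) ⟩
  sumOver (λ i → weight (lookup fs i)) (allFin d) ≤⟨ family-weight fs (2 * k) pointwise ⟩
  n * (2 * k)                                     ∎
  where open ≤-Reasoning

SumBound : ℕ → ℕ → ℕ → ℕ → Set
SumBound γ d n m = (γ + d ≤ n + m) × (γ + d ≡ n + m → (γ ≡ n × d ≡ m) ⊎ (γ ≡ m × d ≡ n))

sum-bound-top : ∀ n m d .{{_ : NonZero n}} → d * n ≤ n * m → SumBound n d n m
sum-bound-top n m d dn≤nm =
  +-monoʳ-≤ n d≤m , λ eq → inj₁ (refl , +-cancelˡ-≡ n d m eq)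
  where
  d≤m : d ≤ m
  d≤m = *-cancelʳ-≤ d m n (≤-trans dn≤nm (≤-reflexive (*-comm n m)))

sum-bound-middle : ∀ m a b d .{{_ : NonZero m}} →
  d * (m + a) ≤ (m + a + b) * m → SumBound (m + a) d (m + a + b) m
sum-bound-middle m a b d dγ≤nm = bound , equality
  where
  γ-nonZero : NonZero (m + a)
  γ-nonZero = >-nonZero (≤-trans (>-nonZero⁻¹ m) (m≤m+n m a))

  -- (n − γ)(γ − m) = a·b measures how far γ is from the extremes.
  excess : (m + a + b) * m + a * b ≡ (m + b) * (m + a)
  excess = identity m a b
    where
    identity : ∀ m a b → (m + a + b) * m + a * b ≡ (m + b) * (m + a)
    identity = solve-∀

  regroup : m + a + (m + b) ≡ m + a + b + m
  regroup = identity m a b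
    where
    identity : ∀ m a b → m + a + (m + b) ≡ m + a + b + m
    identity = solve-∀

  d≤m+b : d ≤ m + b
  d≤m+b = *-cancelʳ-≤ d (m + b) (m + a) {{γ-nonZero}}
            (≤-trans dγ≤nm (≤-trans (m≤m+n _ (a * b)) (≤-reflexive excess)))

  bound : m + a + d ≤ m + a + b + m
  bound = ≤-trans (+-monoʳ-≤ (m + a) d≤m+b) (≤-reflexive regroup)

  -- If d = m + b, the hypothesis reads n·m + a·b ≤ n·m, so a·b = 0.
  no-excess : (m + b) * (m + a) ≤ (m + a + b) * m → a * b ≡ 0
  no-excess le = n≤0⇒n≡0 (+-cancelˡ-≤ ((m + a + b) * m) (a * b) 0
    (≤-trans (≤-reflexive excess) (≤-trans le (≤-reflexive (sym (+-identityʳ _))))))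

  equality : m + a + d ≡ m + a + b + m →
    (m + a ≡ m + a + b × d ≡ m) ⊎ (m + a ≡ m × d ≡ m + a + b)
  equality eq with +-cancelˡ-≡ (m + a) d (m + b) (trans eq (sym regroup))
  ... | refl with m*n≡0⇒m≡0∨n≡0 a (no-excess dγ≤nm)
  ...   | inj₁ refl = inj₂ (+-identityʳ m , cong (_+ b) (sym (+-identityʳ m)))
  ...   | inj₂ refl = inj₁ (sym (+-identityʳ (m + a)) , +-identityʳ m)

sum-bound : ∀ {γ d n m} .{{_ : NonZero m}} .{{_ : NonZero n}} →
  γ ≤ n → m ≤ γ ⊎ n ≤ γ → d * γ ≤ n * m → SumBound γ d n m
sum-bound {γ} {d} {m = m} γ≤n (inj₂ n≤γ) dγ≤nm with ≤-antisym γ≤n n≤γ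
... | refl = sum-bound-top γ m d dγ≤nm
sum-bound {d = d} {m = m} γ≤n (inj₁ m≤γ) dγ≤nm
  with m≤n⇒∃[o]m+o≡n m≤γ | m≤n⇒∃[o]m+o≡n γ≤n
... | a , refl | b , refl = sum-bound-middle m a b d dγ≤nm

extremal-sum : ∀ {γ d n m} → (γ ≡ n × d ≡ m) ⊎ (γ ≡ m × d ≡ n) → γ + d ≡ n + m
extremal-sum (inj₁ (refl , refl))         = refl
extremal-sum {γ} {d} (inj₂ (refl , refl)) = +-comm γ d

theorem4 : (k n : ℕ) → 1 ≤ k → 2 ≤ n → (G : Graph n) → (γ d : ℕ) →
    IsRomanKDominationNumber G k γ → IsRomanKKDomaticNumber G k d →
    (γ + d ≤ n + 2 * k) ×
    ((γ + d ≡ n + 2 * k) ⇔ ((γ ≡ n × d ≡ 2 * k) ⊎ (γ ≡ 2 * k × d ≡ n)))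
theorem4 k n 1≤k 2≤n G γ d isγ (family , _) =
  proj₁ bounded , mk⇔ (proj₂ bounded) extremal-sum
  where
  bounded : SumBound γ d n (2 * k)
  bounded = sum-bound {{>-nonZero (≤-trans (s≤s z≤n) (*-monoʳ-≤ 2 1≤k))}}
                      {{>-nonZero (≤-trans (s≤s z≤n) 2≤n)}}
              (domination-≤-order G k γ isγ)
              (domination-lower G k γ isγ)
              (domatic-bound G k γ d isγ family)
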